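{- Let $(I,C)$ be a hypergraph (finite set of agents $I$, finite set of contracts $C$, each contract $c$ with nonempty participant set $P(c)\subseteq I$, parallel contracts allowed) equipped with Plott choice functions $f_i$ on $C(i)$, $i\in I$. Then there exist a hypergraph $(I',C')$ equipped with weak orders and a hypergraph homomorphism $\pi:(I',C')\to(I,C)$ such that: (a) for every stable system $S'\subseteq C'$, its image $\pi(S')$ is a stable system in $C$; (b) for every stable system $S\subseteq C$ there is a stable system $S'\subseteq C'$ with $\pi(S')=S$.
   Context: For $S\subseteq C$ and $i\in I$, $S(i)=\{s\in S: i\in P(s)\}$; an equipment of $(I,C)$ assigns to each agent $i$ a choice function $f_i$ on $C(i)$. A choice function on a finite set $X$ is a map $f:2^X\to2^X$ with $f(A)\subseteq A$; it is a Plott function if $f(A\cup B)=f(f(A)\cup B)$ for all $A,B\subseteq X$. An equipment by weak orders means each agent $i$ has a weak order (complete preorder) $\le_i$ on $C(i)$ and $f_i(A)$ is the set of $\le_i$-maximal elements of $A$. A hypergraph homomorphism $\pi$ maps agents to agents and contracts to contracts so that $P(\pi(c'))=\pi(P(c'))$ for each $c'\in C'$. A system $S\subseteq C$ is stable if (S0) $f_i(S(i))=S(i)$ for all $i\in I$, and (S*) for every $b\in C\setminus S$ there is $i\in P(b)$ with $b\notin f_i(S(i)\cup\{b\})$. -}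

module Defs where

open import Data.Nat using (ℕ)
open import Data.Fin using (Fin)
open import Data.Fin.Subset using (Subset; _∈_; _∉_; _⊆_; _∪_; _∩_; ⁅_⁆; Nonempty)
open import Data.Fin.Subset.Properties using (_∈?_)
open import Data.Vec using (tabulate)
open import Relation.Nullary using (¬_; does)
open import Relation.Binary.PropositionalEquality using (_≡_)
open import Data.Product using (Σ; ∃; _×_)
open import Data.Sum using (_⊎_)
open import Function.Bundles using (_⇔_)

record Hypergraph : Set where
  field
    nA : ℕ
    nC : ℕ
    P  : Fin nC → Subset nA
    P-nonempty : ∀ c → Nonempty (P c)

  Agent : Set
  Agent = Fin nA

  Contract : Set
  Contract = Fin nC

  C[_] : Agent → Subset nC
  C[ i ] = tabulate (λ c → does (i ∈? P c))

  _[_] : Subset nC → Agent → Subset nC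
  S [ i ] = S ∩ C[ i ]

open Hypergraph public

-- Generic stability, for an equipment given by its "chosen" membership
-- predicate: ch i A c  means  c ∈ f_i(A).
module _ (H : Hypergraph) (ch : Agent H → Subset (nC H) → Contract H → Set) where
  Stable : Subset (nC H) → Set
  Stable S =
    (∀ (i : Agent H) (c : Contract H) → ch i (_[_] H S i) c ⇔ c ∈ _[_] H S i)
    × (∀ (b : Contract H) → b ∉ S →
         ∃ λ (i : Agent H) → i ∈ P H b × ¬ ch i (_[_] H S i ∪ ⁅ b ⁆) b)

-- Plott choice functions on C(i), i ∈ I.  A choice function on C(i) is
-- represented as a map on Subset nC whose values matter only on subsets of C(i).
record PlottEquipment (H : Hypergraph) : Set where
  field
    f : Agent H → Subset (nC H) → Subset (nC H)
    f-choice : ∀ i A → A ⊆ C[_] H i → f i A ⊆ A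
    f-plott  : ∀ i A B → A ⊆ C[_] H i → B ⊆ C[_] H i →
                 f i (A ∪ B) ≡ f i (f i A ∪ B)

plottChosen : (H : Hypergraph) → PlottEquipment H →
              Agent H → Subset (nC H) → Contract H → Set
plottChosen H E i A c = c ∈ PlottEquipment.f E i A

record WeakOrderOn {m : ℕ} (X : Subset m) (_≤_ : Fin m → Fin m → Set) : Set where
  field
    total : ∀ x y → x ∈ X → y ∈ X → (x ≤ y) ⊎ (y ≤ x)
    trans : ∀ x y z → x ∈ X → y ∈ X → z ∈ X → x ≤ y → y ≤ z → x ≤ z

record WeakOrderEquipment (H : Hypergraph) : Set₁ where
  field
    le : Agent H → Contract H → Contract H → Set
    le-weak : ∀ i → WeakOrderOn (C[_] H i) (le i)

weakChosen : (H : Hypergraph) → WeakOrderEquipment H →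
             Agent H → Subset (nC H) → Contract H → Set
weakChosen H E i A c =
  c ∈ A × (∀ b → b ∈ A → ¬ (le i c b × ¬ le i b c))
  where open WeakOrderEquipment E

record Hom (H' H : Hypergraph) : Set where
  field
    πA : Agent H' → Agent H
    πC : Contract H' → Contract H
    πP : ∀ (c' : Contract H') (i : Agent H) →
           (i ∈ P H (πC c') ⇔ (∃ λ i' → i' ∈ P H' c' × πA i' ≡ i))

IsImage : {H' H : Hypergraph} → Hom H' H → Subset (nC H') → Subset (nC H) → Set
IsImage {H'} {H} π S' T =
  ∀ (c : Contract H) → (c ∈ T ⇔ (∃ λ c' → c' ∈ S' × Hom.πC π c' ≡ c))

{-# OPTIONS --safe #-}
-- Let X ⊆ C(i) be the contracts c with c ∈ f({c}).  For a label A, peel X into layers,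
-- each time removing f of what is left, or only its part outside A when that is nonempty,
-- and rank contracts by the size of what was left when they were removed.  Heredity and
-- outcast (both consequences of the Plott identity) show that every maximiser of rank A on
-- B ⊆ X lies in f B, and that f B maximises rank B on B.
--
-- The cover has an agent (i , A) for each agent i and label A, ordering contracts by
-- rank A, and a copy of each contract c for every choice of labels of its participants,
-- kept when c ∈ f_j({c}) for all participants j.  If S' is stable and some z ∈ π S' were
-- above c ∈ π S' for the label used by i on a preimage of c, the copy of z relabelled at i
-- would top all its participants, so would belong to S' and beat that preimage.  A stable S
-- lifts to the copies of its contracts that top S(j) for the label of each participant j;
-- any copy outside this lift is rejected, by a participant whose label ranks some lift
-- higher, or by the participant rejecting the contract from S.
module Submission where

open import Defs
open import Data.Bool using (true; false)
open import Data.Bool.Properties using () renaming (_≟_ to _≟ᵇ_)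
open import Data.Empty using (⊥-elim)
open import Data.Unit using (tt) renaming (⊤ to Unit)
open import Data.Fin using (Fin; zero; suc)
open import Data.Fin.Properties using (any?; all?; decFinSubset) renaming (_≟_ to _≟ᶠ_)
open import Data.Fin.Subset
open import Data.Fin.Subset.Properties
open import Data.List using (List; []; _∷_; length; filter; map; cartesianProduct; allFin)
import Data.List as List
open import Data.List.Membership.Propositional using () renaming (_∈_ to _∈ₗ_)
open import Data.List.Membership.Propositional.Properties
  using (∈-filter⁺; ∈-filter⁻; ∈-lookup; ∈-map⁺; ∈-cartesianProduct⁺; ∈-allFin)
open import Data.List.Relation.Unary.Any using (here; there)
import Data.List.Relation.Unary.Any as Any
open import Data.List.Relation.Unary.Any.Properties using (lookup-index)
open import Data.Nat using (ℕ; zero; suc; _≤_; _<_; z≤n; s≤s; _≤?_)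
open import Data.Nat.Properties
  using (≤-refl; ≤-reflexive; ≤-trans; ≤-total; <-≤-trans; ≤-<-trans; <⇒≤; <⇒≱; ≰⇒≥; ≮⇒≥)
open import Data.Product using (Σ; ∃; _×_; _,_; proj₁; proj₂)
open import Data.Sum using (_⊎_; inj₁; inj₂; [_,_]′)
open import Data.Vec using (Vec; []; _∷_; tabulate; lookup; _[_]≔_; here; there)
open import Data.Vec.Properties
  using (lookup∘tabulate; []=⇒lookup; lookup⇒[]=; lookup∘update; lookup∘update′; ≡-dec)
open import Function using (id; _∘_)
open import Function.Bundles using (mk⇔; Equivalence)
open import Level using (0ℓ)
open import Relation.Nullary using (¬_; Dec; yes; no; does)
open import Relation.Nullary.Decidable using (dec-true; _×-dec_; _→-dec_; ¬?)
open import Relation.Unary using (Pred; Decidable)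
open import Relation.Binary.PropositionalEquality

x∈p─q⇒x∉q : ∀ {n} {x : Fin n} (p q : Subset n) → x ∈ p ─ q → x ∉ q
x∈p─q⇒x∉q (true ∷ p) (true ∷ q) () here
x∈p─q⇒x∉q (false ∷ p) (true ∷ q) () here
x∈p─q⇒x∉q (_ ∷ p) (_ ∷ q) (there x∈) (there x∈q) = x∈p─q⇒x∉q p q x∈ x∈q

module _ {n : ℕ} {p q r : Subset n} where

  ∪-least : p ⊆ r → q ⊆ r → p ∪ q ⊆ r
  ∪-least p⊆r q⊆r x∈ = [ p⊆r , q⊆r ]′ (x∈p∪q⁻ p q x∈)

module _ {n : ℕ} {p q : Subset n} where

  p⊆q⇒p∪q≡q : p ⊆ q → p ∪ q ≡ q
  p⊆q⇒p∪q≡q p⊆q = ⊆-antisym (∪-least p⊆q id) (q⊆p∪q p q)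

  p⊆q⇒q∪p≡q : p ⊆ q → q ∪ p ≡ q
  p⊆q⇒q∪p≡q p⊆q = trans (∪-comm q p) (p⊆q⇒p∪q≡q p⊆q)

  p⊆q⇒p∪[q─p]≡q : p ⊆ q → p ∪ (q ─ p) ≡ q
  p⊆q⇒p∪[q─p]≡q p⊆q = ⊆-antisym (∪-least p⊆q (p─q⊆p q p)) split
    where
    split : q ⊆ p ∪ (q ─ p)
    split {x} x∈q with x ∈? p
    ... | yes x∈p = x∈p∪q⁺ (inj₁ x∈p)
    ... | no x∉p = x∈p∪q⁺ (inj₂ (x∈p∧x∉q⇒x∈p─q x∈q x∉p))

  Empty⇒p∪q≡q : Empty p → p ∪ q ≡ q
  Empty⇒p∪q≡q p-empty = trans (cong (_∪ q) (Empty-unique p-empty)) (∪-identityˡ q)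

x∈p⇒⁅x⁆⊆p : ∀ {n} {x : Fin n} {p : Subset n} → x ∈ p → ⁅ x ⁆ ⊆ p
x∈p⇒⁅x⁆⊆p {x = x} {p} x∈p y∈ = subst (_∈ p) (sym (x∈⁅y⁆⇒x≡y x y∈)) x∈p

module _ {n : ℕ} {P : Pred (Fin n) 0ℓ} (P? : Decidable P) {x : Fin n} where

  ∈-tabulate-does⁺ : P x → x ∈ tabulate (does ∘ P?)
  ∈-tabulate-does⁺ px = lookup⇒[]= x _ (trans (lookup∘tabulate (does ∘ P?) x) (dec-true (P? x) px))

  ∈-tabulate-does⁻ : x ∈ tabulate (does ∘ P?) → P x
  ∈-tabulate-does⁻ x∈ with P? x | trans (sym (lookup∘tabulate (does ∘ P?) x)) ([]=⇒lookup x∈)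
  ... | yes px | _ = px
  ... | no _ | ()

¬⊆⇒∃¬ : ∀ {n} {Q R : Pred (Fin n) 0ℓ} → Decidable Q → Decidable R →
        ¬ (∀ {x} → Q x → R x) → ∃ λ x → Q x × ¬ R x
¬⊆⇒∃¬ {Q = Q} {R} Q? R? ¬Q⊆R with any? (λ x → Q? x ×-dec ¬? (R? x))
... | yes counterexample = counterexample
... | no none = ⊥-elim (¬Q⊆R Q⊆R)
  where
  Q⊆R : ∀ {x} → Q x → R x
  Q⊆R {x} qx with R? x
  ... | yes rx = rx
  ... | no ¬rx = ⊥-elim (none (x , qx , ¬rx))

Empty⊎∃-argmax : ∀ {n} (g : Fin n → ℕ) (B : Subset n) →
                 Empty B ⊎ ∃ λ m → m ∈ B × (∀ {y} → y ∈ B → g y ≤ g m)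
Empty⊎∃-argmax g [] = inj₁ λ ()
Empty⊎∃-argmax g (s ∷ B) with s | Empty⊎∃-argmax (g ∘ suc) B
... | false | inj₁ B-empty = inj₁ λ { (suc y , there y∈) → B-empty (y , y∈) }
... | true | inj₁ B-empty =
  inj₂ (zero , here , λ { here → ≤-refl ; (there y∈) → ⊥-elim (B-empty (_ , y∈)) })
... | false | inj₂ (m , m∈ , max) = inj₂ (suc m , there m∈ , λ { (there y∈) → max y∈ })
... | true | inj₂ (m , m∈ , max) with g zero ≤? g (suc m)
...   | yes g0≤ = inj₂ (suc m , there m∈ , λ { here → g0≤ ; (there y∈) → max y∈ })
...   | no g0≰ =
  inj₂ (zero , here , λ { here → ≤-refl ; (there y∈) → ≤-trans (max y∈) (≰⇒≥ g0≰) })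

maximal-∪⁅⁆ : ∀ {n} (g : Fin n → ℕ) {A : Subset n} {c} → (∀ {y} → y ∈ A → g y ≤ g c) →
              ∀ {y} → y ∈ A ∪ ⁅ c ⁆ → g y ≤ g c
maximal-∪⁅⁆ g {A} {c} c-max y∈ =
  [ c-max , (λ y∈⁅c⁆ → ≤-reflexive (cong g (x∈⁅y⁆⇒x≡y c y∈⁅c⁆))) ]′ (x∈p∪q⁻ A ⁅ c ⁆ y∈)

∃-argmax : ∀ {n} (g : Fin n → ℕ) {B : Subset n} {x} → x ∈ B →
           ∃ λ m → m ∈ B × (∀ {y} → y ∈ B → g y ≤ g m)
∃-argmax g {B} x∈B with Empty⊎∃-argmax g B
... | inj₁ B-empty = ⊥-elim (B-empty (_ , x∈B))
... | inj₂ max = max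

module PlottFunction {n : ℕ} (D : Subset n) (f : Subset n → Subset n)
    (f-choice : ∀ A → A ⊆ D → f A ⊆ A)
    (f-plott : ∀ A B → A ⊆ D → B ⊆ D → f (A ∪ B) ≡ f (f A ∪ B)) where

  open ≡-Reasoning

  heredity : ∀ {B B' x} → B ⊆ B' → B' ⊆ D → x ∈ B → x ∈ f B' → x ∈ f B
  heredity {B} {B'} {x} B⊆B' B'⊆D x∈B x∈fB' =
    [ id , (λ x∈B'─B → ⊥-elim (x∈p─q⇒x∉q B' B x∈B'─B x∈B)) ]′
    (x∈p∪q⁻ (f B) (B' ─ B) x∈fB∪rest)
    where
    B⊆D : B ⊆ D
    B⊆D = ⊆-trans B⊆B' B'⊆D
    rest⊆D : B' ─ B ⊆ D
    rest⊆D = ⊆-trans (p─q⊆p B' B) B'⊆D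
    fB'≡ : f B' ≡ f (f B ∪ (B' ─ B))
    fB'≡ = begin
      f B'               ≡⟨ cong f (sym (p⊆q⇒p∪[q─p]≡q B⊆B')) ⟩
      f (B ∪ (B' ─ B))   ≡⟨ f-plott B (B' ─ B) B⊆D rest⊆D ⟩
      f (f B ∪ (B' ─ B)) ∎
    x∈fB∪rest : x ∈ f B ∪ (B' ─ B)
    x∈fB∪rest = f-choice _ (∪-least (⊆-trans (f-choice B B⊆D) B⊆D) rest⊆D) (subst (x ∈_) fB'≡ x∈fB')

  outcast : ∀ {B R} → B ⊆ R → R ⊆ D → f R ⊆ B → f B ≡ f R
  outcast {B} {R} B⊆R R⊆D fR⊆B = sym (begin
    f R         ≡⟨ cong f (sym (p⊆q⇒q∪p≡q B⊆R)) ⟩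
    f (R ∪ B)   ≡⟨ f-plott R B R⊆D (⊆-trans B⊆R R⊆D) ⟩
    f (f R ∪ B) ≡⟨ cong f (p⊆q⇒p∪q≡q fR⊆B) ⟩
    f B         ∎)

  Acceptable : Fin n → Set
  Acceptable x = x ∈ f ⁅ x ⁆

  chosen⇒Acceptable : ∀ {B x} → B ⊆ D → x ∈ f B → Acceptable x
  chosen⇒Acceptable B⊆D x∈fB =
    heredity (x∈p⇒⁅x⁆⊆p (f-choice _ B⊆D x∈fB)) B⊆D (x∈⁅x⁆ _) x∈fB

  Acceptable⇒f-Nonempty : ∀ {R x} → R ⊆ D → x ∈ R → Acceptable x → Nonempty (f R)
  Acceptable⇒f-Nonempty {R} {x} R⊆D x∈R x-acc with nonempty? (f R)
  ... | yes fR-nonempty = fR-nonempty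
  ... | no fR-empty = x , subst (x ∈_) f⁅x⁆≡fR x-acc
    where
    f⁅x⁆≡fR : f ⁅ x ⁆ ≡ f R
    f⁅x⁆≡fR = begin
      f ⁅ x ⁆         ≡⟨ cong f (sym (Empty⇒p∪q≡q fR-empty)) ⟩
      f (f R ∪ ⁅ x ⁆) ≡⟨ sym (f-plott R ⁅ x ⁆ R⊆D (⊆-trans (x∈p⇒⁅x⁆⊆p x∈R) R⊆D)) ⟩
      f (R ∪ ⁅ x ⁆)   ≡⟨ cong f (p⊆q⇒q∪p≡q (x∈p⇒⁅x⁆⊆p x∈R)) ⟩
      f R             ∎

  acceptables : Subset n
  acceptables = D ∩ tabulate (does ∘ λ x → x ∈? f ⁅ x ⁆)

  acceptables⊆D : acceptables ⊆ D
  acceptables⊆D = p∩q⊆p _ _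

  acceptables⁺ : ∀ {x} → x ∈ D → Acceptable x → x ∈ acceptables
  acceptables⁺ x∈D x-acc = x∈p∩q⁺ (x∈D , ∈-tabulate-does⁺ (λ x → x ∈? f ⁅ x ⁆) x-acc)

  acceptables⁻ : ∀ {x} → x ∈ acceptables → Acceptable x
  acceptables⁻ x∈ = ∈-tabulate-does⁻ (λ x → x ∈? f ⁅ x ⁆) (p∩q⊆q _ _ x∈)

  chosen∈acceptables : ∀ {B x} → B ⊆ D → x ∈ f B → x ∈ acceptables
  chosen∈acceptables B⊆D x∈fB = acceptables⁺ (B⊆D (f-choice _ B⊆D x∈fB)) (chosen⇒Acceptable B⊆D x∈fB)

  -- Layers lie in f R, which makes rank maximisers chosen (heredity); preferring f R ─ A
  -- leaves A untouched until f R ⊆ A, when f A = f R (outcast) is the next layer.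
  layer : Subset n → Subset n → Subset n
  layer A R with nonempty? (f R ─ A)
  ... | yes _ = f R ─ A
  ... | no _ = f R

  layer⊆f : ∀ A R → layer A R ⊆ f R
  layer⊆f A R with nonempty? (f R ─ A)
  ... | yes _ = p─q⊆p (f R) A
  ... | no _ = id

  layer-outside : ∀ A R → Nonempty (f R ─ A) → layer A R ≡ f R ─ A
  layer-outside A R ne with nonempty? (f R ─ A)
  ... | yes _ = refl
  ... | no empty = ⊥-elim (empty ne)

  layer-inside : ∀ A R → Empty (f R ─ A) → layer A R ≡ f R
  layer-inside A R empty with nonempty? (f R ─ A)
  ... | yes ne = ⊥-elim (empty ne)
  ... | no _ = refl

  layer-shrinks : ∀ A {R x} → R ⊆ acceptables → x ∈ R → ∣ R ─ layer A R ∣ < ∣ R ∣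
  layer-shrinks A {R} R⊆acc x∈R =
    p∩q≢∅⇒∣p─q∣<∣p∣ R (layer A R) (w , x∈p∩q⁺ (f-choice R R⊆D (layer⊆f A R w∈) , w∈))
    where
    R⊆D : R ⊆ D
    R⊆D = ⊆-trans R⊆acc acceptables⊆D
    nonempty-layer : Nonempty (layer A R)
    nonempty-layer with nonempty? (f R ─ A)
    ... | yes ne = ne
    ... | no _ = Acceptable⇒f-Nonempty R⊆D x∈R (acceptables⁻ (R⊆acc x∈R))
    w = proj₁ nonempty-layer
    w∈ = proj₂ nonempty-layer

  rankWith : ℕ → Subset n → Subset n → Fin n → ℕ
  rankWith zero A R y = 0
  rankWith (suc k) A R y with y ∈? layer A R
  ... | yes _ = ∣ R ∣
  ... | no _ = rankWith k A (R ─ layer A R) y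

  rankWith-layer : ∀ k A R {y} → y ∈ layer A R → rankWith (suc k) A R y ≡ ∣ R ∣
  rankWith-layer k A R {y} y∈L with y ∈? layer A R
  ... | yes _ = refl
  ... | no y∉L = ⊥-elim (y∉L y∈L)

  rankWith-rest : ∀ k A R {y} → y ∉ layer A R → rankWith (suc k) A R y ≡ rankWith k A (R ─ layer A R) y
  rankWith-rest k A R {y} y∉L with y ∈? layer A R
  ... | yes y∈L = ⊥-elim (y∉L y∈L)
  ... | no _ = refl

  rankWith≤∣R∣ : ∀ k A R y → rankWith k A R y ≤ ∣ R ∣
  rankWith≤∣R∣ zero A R y = z≤n
  rankWith≤∣R∣ (suc k) A R y with y ∈? layer A R
  ... | yes _ = ≤-refl
  ... | no _ = ≤-trans (rankWith≤∣R∣ k A (R ─ layer A R) y) (∣p─q∣≤∣p∣ R (layer A R))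

  rankWith-max⇒chosen : ∀ k A R → R ⊆ acceptables → ∣ R ∣ < k → ∀ {B x} → B ⊆ R → x ∈ B →
                        (∀ {z} → z ∈ B → rankWith k A R z ≤ rankWith k A R x) → x ∈ f B
  rankWith-max⇒chosen (suc k) A R R⊆acc (s≤s ∣R∣≤k) {B} {x} B⊆R x∈B x-max = by-cases (x ∈? layer A R)
    where
    R' = R ─ layer A R
    shrink : ∣ R' ∣ < ∣ R ∣
    shrink = layer-shrinks A R⊆acc (B⊆R x∈B)
    by-cases : Dec (x ∈ layer A R) → x ∈ f B
    by-cases (yes x∈L) = heredity B⊆R (⊆-trans R⊆acc acceptables⊆D) x∈B (layer⊆f A R x∈L)
    by-cases (no x∉L) =
      rankWith-max⇒chosen k A R' (⊆-trans (p─q⊆p R _) R⊆acc) (<-≤-trans shrink ∣R∣≤k) B⊆R' x∈B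
        (λ z∈B → subst₂ _≤_ (rankWith-rest k A R (B∩layer≡∅ z∈B)) x-rank (x-max z∈B))
      where
      x-rank : rankWith (suc k) A R x ≡ rankWith k A R' x
      x-rank = rankWith-rest k A R x∉L
      B∩layer≡∅ : ∀ {z} → z ∈ B → z ∉ layer A R
      B∩layer≡∅ {z} z∈B z∈L = <⇒≱ (≤-<-trans (rankWith≤∣R∣ k A R' x) shrink)
        (subst₂ _≤_ (rankWith-layer k A R z∈L) x-rank (x-max z∈B))
      B⊆R' : B ⊆ R'
      B⊆R' z∈B = x∈p∧x∉q⇒x∈p─q (B⊆R z∈B) (B∩layer≡∅ z∈B)

  chosen⇒rankWith-max : ∀ k R → R ⊆ acceptables → ∣ R ∣ < k → ∀ {B x} → B ⊆ R → x ∈ f B →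
                        ∀ {z} → z ∈ B → rankWith k B R z ≤ rankWith k B R x
  chosen⇒rankWith-max (suc k) R R⊆acc (s≤s ∣R∣≤k) {B} {x} B⊆R x∈fB {z} z∈B =
    by-cases (nonempty? (f R ─ B))
    where
    R⊆D : R ⊆ D
    R⊆D = ⊆-trans R⊆acc acceptables⊆D
    x∈B : x ∈ B
    x∈B = f-choice B (⊆-trans B⊆R R⊆D) x∈fB
    by-cases : Dec (Nonempty (f R ─ B)) → rankWith (suc k) B R z ≤ rankWith (suc k) B R x
    by-cases (yes outside-B) =
      subst₂ _≤_ (sym (rankWith-rest k B R (B∩layer≡∅ z∈B))) (sym (rankWith-rest k B R (B∩layer≡∅ x∈B)))
        (chosen⇒rankWith-max k R' (⊆-trans (p─q⊆p R _) R⊆acc)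
          (<-≤-trans (layer-shrinks B R⊆acc (B⊆R x∈B)) ∣R∣≤k) B⊆R' x∈fB z∈B)
      where
      R' = R ─ layer B R
      B∩layer≡∅ : ∀ {y} → y ∈ B → y ∉ layer B R
      B∩layer≡∅ y∈B y∈L = x∈p─q⇒x∉q (f R) B (subst (_ ∈_) (layer-outside B R outside-B) y∈L) y∈B
      B⊆R' : B ⊆ R'
      B⊆R' y∈B = x∈p∧x∉q⇒x∈p─q (B⊆R y∈B) (B∩layer≡∅ y∈B)
    by-cases (no none-outside-B) =
      subst (rankWith (suc k) B R z ≤_) (sym (rankWith-layer k B R x∈L)) (rankWith≤∣R∣ (suc k) B R z)
      where
      fR⊆B : f R ⊆ B
      fR⊆B {y} y∈fR with y ∈? B
      ... | yes y∈B = y∈B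
      ... | no y∉B = ⊥-elim (none-outside-B (y , x∈p∧x∉q⇒x∈p─q y∈fR y∉B))
      x∈L : x ∈ layer B R
      x∈L = subst (x ∈_) (sym (layer-inside B R none-outside-B)) (subst (x ∈_) (outcast B⊆R R⊆D fR⊆B) x∈fB)

  rank : Subset n → Fin n → ℕ
  rank A = rankWith (suc n) A acceptables

  rank-max⇒chosen : ∀ A {B x} → B ⊆ acceptables → x ∈ B →
                    (∀ {z} → z ∈ B → rank A z ≤ rank A x) → x ∈ f B
  rank-max⇒chosen A = rankWith-max⇒chosen (suc n) A acceptables id (s≤s (∣p∣≤n acceptables))

  chosen⇒rank-max : ∀ {B x} → B ⊆ acceptables → x ∈ f B → ∀ {z} → z ∈ B → rank B z ≤ rank B x
  chosen⇒rank-max = chosen⇒rankWith-max (suc n) acceptables id (s≤s (∣p∣≤n acceptables))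

module _ (H : Hypergraph) {i : Agent H} {c : Contract H} where

  ∈C[]⁺ : i ∈ P H c → c ∈ C[_] H i
  ∈C[]⁺ = ∈-tabulate-does⁺ (λ c → i ∈? P H c)

  ∈C[]⁻ : c ∈ C[_] H i → i ∈ P H c
  ∈C[]⁻ = ∈-tabulate-does⁻ (λ c → i ∈? P H c)

  ∈[]⁺ : ∀ {S} → c ∈ S → i ∈ P H c → c ∈ _[_] H S i
  ∈[]⁺ c∈S i∈Pc = x∈p∩q⁺ (c∈S , ∈C[]⁺ i∈Pc)

  ∈[]⁻ : ∀ {S} → c ∈ _[_] H S i → c ∈ S × i ∈ P H c
  ∈[]⁻ {S} c∈ = proj₁ (x∈p∩q⁻ S _ c∈) , ∈C[]⁻ (proj₂ (x∈p∩q⁻ S _ c∈))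

module _ (H : Hypergraph) (u : Agent H → Contract H → ℕ) where

  utilityOrders : WeakOrderEquipment H
  utilityOrders = record
    { le = λ i x y → u i x ≤ u i y
    ; le-weak = λ i → record
        { total = λ x y _ _ → ≤-total (u i x) (u i y)
        ; trans = λ _ _ _ _ _ _ → ≤-trans
        }
    }

  module _ {i : Agent H} {c : Contract H} where

    maximal⇒weakChosen : ∀ {A} → c ∈ A → (∀ {b} → b ∈ A → u i b ≤ u i c) →
                         weakChosen H utilityOrders i A c
    maximal⇒weakChosen c∈A c-max = c∈A , λ b b∈A c<b → proj₂ c<b (c-max b∈A)

    weakChosen⇒maximal : ∀ {A} → weakChosen H utilityOrders i A c → ∀ {b} → b ∈ A → u i b ≤ u i c
    weakChosen⇒maximal (_ , c-max) {b} b∈A with u i b ≤? u i c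
    ... | yes b≤c = b≤c
    ... | no b≰c = ⊥-elim (c-max b b∈A (≰⇒≥ b≰c , b≰c))

    maximal⇒weakChosen-∪⁅⁆ : ∀ {A} → (∀ {b} → b ∈ A → u i b ≤ u i c) →
                             weakChosen H utilityOrders i (A ∪ ⁅ c ⁆) c
    maximal⇒weakChosen-∪⁅⁆ c-max =
      maximal⇒weakChosen (x∈p∪q⁺ (inj₂ (x∈⁅x⁆ c))) (maximal-∪⁅⁆ (u i) c-max)

    weakChosen-∪⁅⁆⇒maximal : ∀ {A} → weakChosen H utilityOrders i (A ∪ ⁅ c ⁆) c →
                             ∀ {b} → b ∈ A → u i b ≤ u i c
    weakChosen-∪⁅⁆⇒maximal c-chosen b∈A = weakChosen⇒maximal c-chosen (x∈p∪q⁺ (inj₁ b∈A))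

record Listing {A : Set} (Q : Pred A 0ℓ) : Set where
  field
    size : ℕ
    at : Fin size → A
    at-sat : ∀ k → Q (at k)
    index : ∀ {a} → Q a → Fin size
    at-index : ∀ {a} (q : Q a) → at (index q) ≡ a

filterListing : ∀ {A : Set} {Q : Pred A 0ℓ} → Decidable Q → (xs : List A) → (∀ a → a ∈ₗ xs) → Listing Q
filterListing {Q = Q} Q? xs complete = record
  { size = length (filter Q? xs)
  ; at = List.lookup (filter Q? xs)
  ; at-sat = λ k → proj₂ (∈-filter⁻ Q? {xs = xs} (∈-lookup k))
  ; index = λ q → Any.index (listed q)
  ; at-index = λ q → sym (lookup-index (listed q))
  }
  where
  listed : ∀ {a} → Q a → a ∈ₗ filter Q? xs
  listed {a} q = ∈-filter⁺ Q? (complete a) q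

vectors : ∀ {A : Set} → List A → (n : ℕ) → List (Vec A n)
vectors xs zero = [] ∷ []
vectors xs (suc n) = map (λ (x , v) → x ∷ v) (cartesianProduct xs (vectors xs n))

∈-vectors : ∀ {A : Set} {xs : List A} → (∀ a → a ∈ₗ xs) → ∀ {n} (v : Vec A n) → v ∈ₗ vectors xs n
∈-vectors complete [] = here refl
∈-vectors complete (x ∷ v) = ∈-map⁺ _ (∈-cartesianProduct⁺ (complete x) (∈-vectors complete v))

subsets : (n : ℕ) → List (Subset n)
subsets = vectors (true ∷ false ∷ [])

∈-subsets : ∀ {n} (p : Subset n) → p ∈ₗ subsets n
∈-subsets = ∈-vectors λ { true → here refl ; false → there (here refl) }

module Construction (H : Hypergraph) (E : PlottEquipment H) where
  open PlottEquipment E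

  module Choice (i : Agent H) = PlottFunction (C[_] H i) (f i) (f-choice i) (f-plott i)
  open Choice using (Acceptable; acceptables; acceptables⁺; acceptables⁻; chosen⇒Acceptable;
                     chosen∈acceptables; rank; rank-max⇒chosen; chosen⇒rank-max)

  -- Agent (i , A) of the cover is agent i of H ranking contracts by rank i A; contract
  -- (c , κ) is a copy of c in which each participant j acts as agent (j , lookup κ j).
  AgentCode : Set
  AgentCode = Agent H × Subset (nC H)

  ContractCode : Set
  ContractCode = Contract H × Vec (Subset (nC H)) (nA H)

  _∈ᴾ_ : AgentCode → ContractCode → Set
  a ∈ᴾ d = proj₁ a ∈ P H (proj₁ d) × lookup (proj₂ d) (proj₁ a) ≡ proj₂ a

  Admissible : Pred ContractCode 0ℓ
  Admissible d = ∀ j → j ∈ P H (proj₁ d) → Acceptable j (proj₁ d)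

  admissible? : Decidable Admissible
  admissible? d = all? (λ j → (j ∈? P H (proj₁ d)) →-dec (proj₁ d ∈? f j ⁅ proj₁ d ⁆))

  agentListing : Listing {A = AgentCode} (λ _ → Unit)
  agentListing = filterListing (λ _ → yes tt) (cartesianProduct (allFin _) (subsets _))
    λ (i , A) → ∈-cartesianProduct⁺ (∈-allFin i) (∈-subsets A)

  contractListing : Listing Admissible
  contractListing = filterListing admissible? (cartesianProduct (allFin _) (vectors (subsets _) _))
    λ (c , κ) → ∈-cartesianProduct⁺ (∈-allFin c) (∈-vectors ∈-subsets κ)

  module Cover (agents : Listing {A = AgentCode} (λ _ → Unit)) (contracts : Listing Admissible) where
    open Listing agents using ()
      renaming (size to nA'; at to agentCode; index to agentIndex; at-index to agentCode-index)
    open Listing contracts using ()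
      renaming (size to nC'; at to contractCode; at-sat to admissible;
                index to contractIndex; at-index to contractCode-index)

    πA : Fin nA' → Agent H
    πA a = proj₁ (agentCode a)

    label : Fin nA' → Subset (nC H)
    label a = proj₂ (agentCode a)

    πC : Fin nC' → Contract H
    πC c' = proj₁ (contractCode c')

    κ : Fin nC' → Vec (Subset (nC H)) (nA H)
    κ c' = proj₂ (contractCode c')

    agentAt : Agent H → Subset (nC H) → Fin nA'
    agentAt i A = agentIndex {i , A} tt

    agentCode-agentAt : ∀ i A → agentCode (agentAt i A) ≡ (i , A)
    agentCode-agentAt i A = agentCode-index tt

    relabel : Fin nC' → Agent H → Subset (nC H) → Fin nC'
    relabel c' i A = contractIndex {πC c' , κ c' [ i ]≔ A} (admissible c')

    contractCode-relabel : ∀ c' i A → contractCode (relabel c' i A) ≡ (πC c' , κ c' [ i ]≔ A)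
    contractCode-relabel c' i A = contractCode-index (admissible c')

    participates? : ∀ a c' → Dec (agentCode a ∈ᴾ contractCode c')
    participates? a c' = (πA a ∈? P H (πC c')) ×-dec ≡-dec _≟ᵇ_ (lookup (κ c') (πA a)) (label a)

    P' : Fin nC' → Subset nA'
    P' c' = tabulate (does ∘ λ a → participates? a c')

    module _ {a c' i A c κ₀} (a-code : agentCode a ≡ (i , A)) (c'-code : contractCode c' ≡ (c , κ₀)) where

      ∈P'⁺ : i ∈ P H c → lookup κ₀ i ≡ A → a ∈ P' c'
      ∈P'⁺ i∈ κ₀i≡A =
        ∈-tabulate-does⁺ (λ a → participates? a c') (subst₂ _∈ᴾ_ (sym a-code) (sym c'-code) (i∈ , κ₀i≡A))

      ∈P'⁻ : a ∈ P' c' → i ∈ P H c × lookup κ₀ i ≡ A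
      ∈P'⁻ a∈ = subst₂ _∈ᴾ_ a-code c'-code (∈-tabulate-does⁻ (λ a → participates? a c') a∈)

    ∈P'⇒∈P : ∀ {a c'} → a ∈ P' c' → πA a ∈ P H (πC c')
    ∈P'⇒∈P = proj₁ ∘ ∈P'⁻ refl refl

    ∈P'⇒label : ∀ {a c'} → a ∈ P' c' → lookup (κ c') (πA a) ≡ label a
    ∈P'⇒label = proj₂ ∘ ∈P'⁻ refl refl

    agentAt∈P' : ∀ {c' i} → i ∈ P H (πC c') → agentAt i (lookup (κ c') i) ∈ P' c'
    agentAt∈P' i∈ = ∈P'⁺ (agentCode-agentAt _ _) refl i∈ refl

    agentAt∈P'-relabel : ∀ {c' i} A → i ∈ P H (πC c') → agentAt i A ∈ P' (relabel c' i A)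
    agentAt∈P'-relabel {c'} {i} A i∈ =
      ∈P'⁺ (agentCode-agentAt i A) (contractCode-relabel c' i A) i∈ (lookup∘update i (κ c') A)

    ∈P'-relabel⁻ : ∀ c' i A {a} → a ∈ P' (relabel c' i A) → agentCode a ≡ (i , A) ⊎ a ∈ P' c'
    ∈P'-relabel⁻ c' i A {a} a∈ with πA a ≟ᶠ i | ∈P'⁻ refl (contractCode-relabel c' i A) a∈
    ... | yes refl | _ , relabelled =
      inj₁ (cong (i ,_) (trans (sym relabelled) (lookup∘update i (κ c') A)))
    ... | no j≢i | j∈ , relabelled =
      inj₂ (∈P'⁺ refl refl j∈ (trans (sym (lookup∘update′ j≢i (κ c') A)) relabelled))

    πC-relabel : ∀ c' i A → πC (relabel c' i A) ≡ πC c'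
    πC-relabel c' i A = cong proj₁ (contractCode-relabel c' i A)

    πC∈acceptables : ∀ c' {i} → i ∈ P H (πC c') → πC c' ∈ acceptables i
    πC∈acceptables c' i∈ = acceptables⁺ _ (∈C[]⁺ H i∈) (admissible c' _ i∈)

    H' : Hypergraph
    H' = record
      { nA = nA'
      ; nC = nC'
      ; P = P'
      ; P-nonempty = λ c' → _ , agentAt∈P' (proj₂ (P-nonempty H (πC c')))
      }

    rank' : Fin nA' → Fin nC' → ℕ
    rank' a c' = rank (πA a) (label a) (πC c')

    rank'-code : ∀ {a i A} → agentCode a ≡ (i , A) → ∀ c' → rank' a c' ≡ rank i A (πC c')
    rank'-code a-code c' = cong (λ d → rank (proj₁ d) (proj₂ d) (πC c')) a-code

    rank'-relabel : ∀ a c' i A → rank' a (relabel c' i A) ≡ rank' a c'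
    rank'-relabel a c' i A = cong (rank (πA a) (label a)) (πC-relabel c' i A)

    W : WeakOrderEquipment H'
    W = utilityOrders H' rank'

    π : Hom H' H
    π = record
      { πA = πA
      ; πC = πC
      ; πP = λ c' i → mk⇔ (λ i∈ → _ , agentAt∈P' i∈ , cong proj₁ (agentCode-agentAt _ _))
                          (λ { (a , a∈ , refl) → ∈P'⇒∈P a∈ })
      }

    module ImageOfStable (S' : Subset nC') (S'-stable : Stable H' (weakChosen H' W) S')
                         (T : Subset (nC H)) (T-image : IsImage π S' T) where

      image⁺ : ∀ {c'} → c' ∈ S' → πC c' ∈ T
      image⁺ c'∈ = Equivalence.from (T-image _) (_ , c'∈ , refl)

      image⁻ : ∀ {c} → c ∈ T → ∃ λ c' → c' ∈ S' × πC c' ≡ c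
      image⁻ = Equivalence.to (T-image _)

      T[i]⊆acceptables : ∀ i → _[_] H T i ⊆ acceptables i
      T[i]⊆acceptables i c∈ with ∈[]⁻ H c∈
      ... | c∈T , i∈ with image⁻ c∈T
      ...   | c' , _ , refl = πC∈acceptables c' i∈

      image-at : ∀ {a y} → y ∈ _[_] H' S' a → πC y ∈ _[_] H T (πA a)
      image-at y∈ = let (y∈S' , a∈) = ∈[]⁻ H' y∈ in ∈[]⁺ H (image⁺ y∈S') (∈P'⇒∈P a∈)

      S'-max : ∀ {a c'} → c' ∈ S' → a ∈ P' c' → ∀ {y} → y ∈ _[_] H' S' a → rank' a y ≤ rank' a c'
      S'-max c'∈ a∈ = weakChosen⇒maximal H' rank' (Equivalence.from (proj₁ S'-stable _ _) (∈[]⁺ H' c'∈ a∈))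

      unrejected⇒∈S' : ∀ {b'} →
                       (∀ {j'} → j' ∈ P' b' → ∀ {y} → y ∈ _[_] H' S' j' → rank' j' y ≤ rank' j' b') →
                       b' ∈ S'
      unrejected⇒∈S' {b'} b'-top with b' ∈? S'
      ... | yes b'∈ = b'∈
      ... | no b'∉ = let (j' , j'∈ , rejects) = proj₂ S'-stable b' b'∉ in
                     ⊥-elim (rejects (maximal⇒weakChosen-∪⁅⁆ H' rank' (b'-top j'∈)))

      -- Otherwise the copy of z' in which i acts as (i , A) would top all its participants,
      -- hence lie in S', where (i , A) prefers it to c'.
      preimage-ranks-below : ∀ {i c' z'} → c' ∈ S' → z' ∈ S' → i ∈ P H (πC c') → i ∈ P H (πC z') →
                             rank i (lookup (κ c') i) (πC z') ≤ rank i (lookup (κ c') i) (πC c')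
      preimage-ranks-below {i} {c'} {z'} c'∈ z'∈ i∈c i∈z = ≮⇒≥ λ c<z → <⇒≱ c<z (c'-beats-b' c<z)
        where
        A = lookup (κ c') i
        b' = relabel z' i A
        rank'-at-b' : ∀ {a} → agentCode a ≡ (i , A) → rank' a b' ≡ rank i A (πC z')
        rank'-at-b' {a} a-code = trans (rank'-relabel a z' i A) (rank'-code a-code z')
        b'-top : rank i A (πC c') < rank i A (πC z') →
                 ∀ {j'} → j' ∈ P' b' → ∀ {y} → y ∈ _[_] H' S' j' → rank' j' y ≤ rank' j' b'
        b'-top c<z {j'} j'∈ {y} y∈ with ∈P'-relabel⁻ z' i A j'∈
        ... | inj₁ j'-code = ≤-trans (S'-max c'∈ (∈P'⁺ j'-code refl i∈c refl) y∈)
                               (<⇒≤ (subst₂ _<_ (sym (rank'-code j'-code c')) (sym (rank'-at-b' j'-code)) c<z))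
        ... | inj₂ j'∈z' = subst (rank' j' y ≤_) (sym (rank'-relabel j' z' i A)) (S'-max z'∈ j'∈z' y∈)
        c'-beats-b' : rank i A (πC c') < rank i A (πC z') → rank i A (πC z') ≤ rank i A (πC c')
        c'-beats-b' c<z = subst₂ _≤_ (rank'-at-b' a-code) (rank'-code a-code c')
          (S'-max c'∈ (agentAt∈P' i∈c) (∈[]⁺ H' (unrejected⇒∈S' (b'-top c<z)) (agentAt∈P'-relabel A i∈z)))
          where
          a-code = agentCode-agentAt i A

      T-chosen : ∀ {i c} → c ∈ _[_] H T i → c ∈ f i (_[_] H T i)
      T-chosen {i} c∈ with ∈[]⁻ H c∈
      ... | c∈T , i∈c with image⁻ c∈T
      ...   | c' , c'∈ , refl = rank-max⇒chosen i (lookup (κ c') i) (T[i]⊆acceptables i) c∈ c'-top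
        where
        c'-top : ∀ {z} → z ∈ _[_] H T i → rank i (lookup (κ c') i) z ≤ rank i (lookup (κ c') i) (πC c')
        c'-top z∈ with ∈[]⁻ H z∈
        ... | z∈T , i∈z with image⁻ z∈T
        ...   | z' , z'∈ , refl = preimage-ranks-below c'∈ z'∈ i∈c i∈z

      -- Otherwise the copy of b in which each participant i acts as (i , T(i) ∪ ⁅ b ⁆) would
      -- top all its participants, hence lie in S'.
      some-participant-rejects : ∀ {b} → b ∉ T → ¬ (∀ {i} → i ∈ P H b → b ∈ f i (_[_] H T i ∪ ⁅ b ⁆))
      some-participant-rejects {b} b∉T accepted =
        b∉T (subst (_∈ T) (cong proj₁ b'-code) (image⁺ (unrejected⇒∈S' b'-top)))
        where
        B : Agent H → Subset (nC H)
        B i = _[_] H T i ∪ ⁅ b ⁆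
        B⊆C : ∀ {i} → i ∈ P H b → B i ⊆ C[_] H i
        B⊆C i∈ = ∪-least (p∩q⊆q _ _) (x∈p⇒⁅x⁆⊆p (∈C[]⁺ H i∈))
        b' = contractIndex {b , tabulate B} (λ j j∈ → chosen⇒Acceptable j (B⊆C j∈) (accepted j∈))
        b'-code : contractCode b' ≡ (b , tabulate B)
        b'-code = contractCode-index _
        b'-top : ∀ {j'} → j' ∈ P' b' → ∀ {y} → y ∈ _[_] H' S' j' → rank' j' y ≤ rank' j' b'
        b'-top {j'} j'∈ y∈ =
          subst₂ _≤_ (sym (rank'-code j'-code _))
            (sym (trans (rank'-code j'-code b') (cong (rank j (B j) ∘ proj₁) b'-code)))
            (chosen⇒rank-max j B⊆acceptables (accepted j∈b) (x∈p∪q⁺ (inj₁ (image-at y∈))))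
          where
          j = πA j'
          j∈b = proj₁ (∈P'⁻ refl b'-code j'∈)
          j'-code : agentCode j' ≡ (j , B j)
          j'-code = cong (j ,_) (trans (sym (proj₂ (∈P'⁻ refl b'-code j'∈))) (lookup∘tabulate B j))
          B⊆acceptables : B j ⊆ acceptables j
          B⊆acceptables =
            ∪-least (T[i]⊆acceptables j) (x∈p⇒⁅x⁆⊆p (chosen∈acceptables j (B⊆C j∈b) (accepted j∈b)))

      stable : Stable H (plottChosen H E) T
      stable = (λ i c → mk⇔ (f-choice i _ (p∩q⊆q _ _)) T-chosen) ,
               (λ b b∉T → ¬⊆⇒∃¬ (_∈? P H b) (λ i → b ∈? f i (_[_] H T i ∪ ⁅ b ⁆))
                                 (some-participant-rejects b∉T))

    module LiftOfStable (S : Subset (nC H)) (S-stable : Stable H (plottChosen H E) S) where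

      S-chosen : ∀ {i c} → c ∈ _[_] H S i → c ∈ f i (_[_] H S i)
      S-chosen = Equivalence.from (proj₁ S-stable _ _)

      S[i]⊆acceptables : ∀ i → _[_] H S i ⊆ acceptables i
      S[i]⊆acceptables i c∈ = chosen∈acceptables i (p∩q⊆q _ _) (S-chosen c∈)

      TopFor : Agent H → Subset (nC H) → Contract H → Set
      TopFor j A c = ∀ {z} → z ∈ _[_] H S j → rank j A z ≤ rank j A c

      topFor? : ∀ j A c → Dec (TopFor j A c)
      topFor? j A c = decFinSubset (_∈? _[_] H S j) (λ {z} _ → rank j A z ≤? rank j A c)

      OnTop : Pred ContractCode 0ℓ
      OnTop d = proj₁ d ∈ S × (∀ {j} → j ∈ P H (proj₁ d) → TopFor j (lookup (proj₂ d) j) (proj₁ d))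

      onTop? : Decidable OnTop
      onTop? d = (proj₁ d ∈? S) ×-dec
                 decFinSubset (_∈? P H (proj₁ d)) (λ {j} _ → topFor? j (lookup (proj₂ d) j) (proj₁ d))

      S' : Subset nC'
      S' = tabulate (does ∘ λ c' → onTop? (contractCode c'))

      S'⁺ : ∀ {c'} → OnTop (contractCode c') → c' ∈ S'
      S'⁺ = ∈-tabulate-does⁺ (λ c' → onTop? (contractCode c'))

      S'⁻ : ∀ {c'} → c' ∈ S' → OnTop (contractCode c')
      S'⁻ = ∈-tabulate-does⁻ (λ c' → onTop? (contractCode c'))

      lift : ∀ {c κ₀} → OnTop (c , κ₀) → ∃ λ c' → c' ∈ S' × contractCode c' ≡ (c , κ₀)
      lift {c} {κ₀} on-top = c' , S'⁺ (subst OnTop (sym c'-code) on-top) , c'-code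
        where
        admissible-c : Admissible (c , κ₀)
        admissible-c j j∈ = acceptables⁻ j (S[i]⊆acceptables j (∈[]⁺ H (proj₁ on-top) j∈))
        c' = contractIndex admissible-c
        c'-code = contractCode-index admissible-c

      κS : Vec (Subset (nC H)) (nA H)
      κS = tabulate (_[_] H S)

      top-for-κS : ∀ {c j} → c ∈ S → j ∈ P H c → TopFor j (lookup κS j) c
      top-for-κS {c} {j} c∈ j∈ = subst (λ A → TopFor j A c) (sym (lookup∘tabulate (_[_] H S) j))
                                   (chosen⇒rank-max j (S[i]⊆acceptables j) (S-chosen (∈[]⁺ H c∈ j∈)))

      top-for-κS[i]≔A : ∀ {c i A j} → c ∈ S → TopFor i A c → j ∈ P H c →
                        TopFor j (lookup (κS [ i ]≔ A) j) c
      top-for-κS[i]≔A {c} {i} {A} {j} c∈ top j∈ with j ≟ᶠ i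
      ... | yes refl = subst (λ A → TopFor j A c) (sym (lookup∘update i κS A)) top
      ... | no j≢i = subst (λ A → TopFor j A c) (sym (lookup∘update′ j≢i κS A)) (top-for-κS c∈ j∈)

      S'-image : IsImage π S' S
      S'-image c = mk⇔ (λ c∈ → let (c' , c'∈ , c'-code) = lift {c} {κS} (c∈ , top-for-κS c∈) in
                                c' , c'∈ , cong proj₁ c'-code)
                       (λ { (c' , c'∈ , refl) → proj₁ (S'⁻ c'∈) })

      dominated-by-lift : ∀ a {z} → z ∈ _[_] H S (πA a) →
                          ∃ λ z' → z' ∈ _[_] H' S' a × rank (πA a) (label a) z ≤ rank' a z'
      dominated-by-lift a {z} z∈ with ∃-argmax (rank (πA a) (label a)) z∈
      ... | m , m∈ , m-max with ∈[]⁻ H m∈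
      ...   | m∈S , i∈m with lift {m} {κS [ πA a ]≔ label a} (m∈S , top-for-κS[i]≔A m∈S m-max)
      ...     | z' , z'∈ , z'-code =
                z' , ∈[]⁺ H' z'∈ (∈P'⁺ refl z'-code i∈m (lookup∘update (πA a) κS (label a))) ,
                subst (rank (πA a) (label a) z ≤_) (sym (cong (rank (πA a) (label a) ∘ proj₁) z'-code)) (m-max z∈)

      weakChosen⇒TopFor : ∀ {a b'} → weakChosen H' W a (_[_] H' S' a ∪ ⁅ b' ⁆) b' →
                          TopFor (πA a) (label a) (πC b')
      weakChosen⇒TopFor {a} b'-chosen z∈ = let (z' , z'∈ , z≤z') = dominated-by-lift a z∈ in
        ≤-trans z≤z' (weakChosen-∪⁅⁆⇒maximal H' rank' b'-chosen z'∈)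

      S'-chosen : ∀ {a c'} → c' ∈ _[_] H' S' a → weakChosen H' W a (_[_] H' S' a) c'
      S'-chosen {a} {c'} c'∈ = maximal⇒weakChosen H' rank' c'∈ λ b'∈ →
        let (b'∈S' , a∈b') = ∈[]⁻ H' {i = a} b'∈ in
        subst (λ A → rank (πA a) A (πC _) ≤ rank (πA a) A (πC c')) (∈P'⇒label a∈c')
          (proj₂ (S'⁻ c'∈S') (∈P'⇒∈P a∈c') (∈[]⁺ H (proj₁ (S'⁻ b'∈S')) (∈P'⇒∈P a∈b')))
        where
        c'∈S' = proj₁ (∈[]⁻ H' {i = a} c'∈)
        a∈c' = proj₂ (∈[]⁻ H' {i = a} c'∈)

      weakChosen⇒TopFor-agentAt : ∀ {b'} i → let a = agentAt i (lookup (κ b') i) in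
                                  weakChosen H' W a (_[_] H' S' a ∪ ⁅ b' ⁆) b' → TopFor i (lookup (κ b') i) (πC b')
      weakChosen⇒TopFor-agentAt {b'} i b'-chosen =
        subst (λ d → TopFor (proj₁ d) (proj₂ d) (πC b')) (agentCode-agentAt i _) (weakChosen⇒TopFor b'-chosen)

      TopFor⇒chosen : ∀ {i A b} → b ∈ acceptables i → TopFor i A b → b ∈ f i (_[_] H S i ∪ ⁅ b ⁆)
      TopFor⇒chosen {i} {A} b-acc b-top =
        rank-max⇒chosen i A (∪-least (S[i]⊆acceptables i) (x∈p⇒⁅x⁆⊆p b-acc))
          (x∈p∪q⁺ (inj₂ (x∈⁅x⁆ _))) (maximal-∪⁅⁆ (rank i A) b-top)

      not-TopFor : ∀ {b'} → b' ∉ S' → ∃ λ i → i ∈ P H (πC b') × ¬ TopFor i (lookup (κ b') i) (πC b')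
      not-TopFor {b'} b'∉ with πC b' ∈? S
      ... | yes b∈S = ¬⊆⇒∃¬ (_∈? P H (πC b')) (λ j → topFor? j (lookup (κ b') j) (πC b'))
                            (λ tops → b'∉ (S'⁺ (b∈S , tops)))
      ... | no b∉S = let (i , i∈ , i-rejects) = proj₂ S-stable (πC b') b∉S in
                     i , i∈ , i-rejects ∘ TopFor⇒chosen (πC∈acceptables b' i∈)

      S'-blocked : ∀ b' → b' ∉ S' → ∃ λ a → a ∈ P' b' × ¬ weakChosen H' W a (_[_] H' S' a ∪ ⁅ b' ⁆) b'
      S'-blocked b' b'∉ = let (i , i∈ , ¬top) = not-TopFor b'∉ in
        agentAt i (lookup (κ b') i) , agentAt∈P' i∈ , ¬top ∘ weakChosen⇒TopFor-agentAt i

      stable : Stable H' (weakChosen H' W) S'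
      stable = (λ a c' → mk⇔ proj₁ S'-chosen) , S'-blocked

theorem3p1 : (H : Hypergraph) (E : PlottEquipment H) →
    Σ Hypergraph λ H' → Σ (WeakOrderEquipment H') λ W → Σ (Hom H' H) λ π →
      ((S' : Subset (nC H')) → Stable H' (weakChosen H' W) S' →
         (T : Subset (nC H)) → IsImage π S' T → Stable H (plottChosen H E) T)
      × ((S : Subset (nC H)) → Stable H (plottChosen H E) S →
         ∃ λ (S' : Subset (nC H')) → Stable H' (weakChosen H' W) S' × IsImage π S' S)
theorem3p1 H E =
  H' , W , π ,
  (λ S' S'-stable T T-image → ImageOfStable.stable S' S'-stable T T-image) ,
  (λ S S-stable → let open LiftOfStable S S-stable in S' , stable , S'-image)
  where
  open Construction H E
  open Cover agentListing contractListing
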